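{- Let $r$ be a positive integer, let $G$ be an $r$-BG graph with at least $r+1$ vertices, and let $A_0$ be a percolating set of $G$ (with threshold $r$) with $|A_0|=r$. If $X$ is a cut set of $G$ with $|X|<r$, then at least one vertex of $X$ is adjacent to every vertex of $A_0$.
   Context: Bootstrap percolation with threshold $r$ on a finite simple graph $G$: starting from an initially infected set $A_0\subseteq V(G)$, define $A_t=A_{t-1}\cup\{v\in V(G): |N(v)\cap A_{t-1}|\ge r\}$ for $t\ge1$; $A_0$ percolates if eventually every vertex is infected. $G$ is $r$-bootstrap good ($r$-BG) if it contains a set of $r$ vertices which percolates with threshold $r$. A cut set of $G$ is a set $X\subseteq V(G)$ such that $G-X$ is disconnected. -}

module Defs where

open import Data.Nat using (ℕ; zero; suc; _≤ᵇ_)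
open import Data.Bool using (Bool; true; false)
open import Data.Fin using (Fin)
open import Data.Fin.Subset using (Subset; _∈_; _∉_; _∩_; _∪_; ∣_∣; ⊤; ∁)
open import Data.Vec using (tabulate)
open import Data.Product using (Σ; ∃; _×_)
open import Relation.Binary.PropositionalEquality using (_≡_)
open import Relation.Nullary using (¬_)

record Graph (n : ℕ) : Set where
  field
    adj   : Fin n → Fin n → Bool
    sym   : ∀ u v → adj u v ≡ adj v u
    irrefl : ∀ v → adj v v ≡ false
open Graph public

N : ∀ {n} → Graph n → Fin n → Subset n
N G v = tabulate (adj G v)

step : ∀ {n} → Graph n → ℕ → Subset n → Subset n
step G r A = A ∪ tabulate (λ v → r ≤ᵇ ∣ N G v ∩ A ∣)

infected : ∀ {n} → Graph n → ℕ → Subset n → ℕ → Subset n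
infected G r A zero    = A
infected G r A (suc t) = step G r (infected G r A t)

Percolates : ∀ {n} → Graph n → ℕ → Subset n → Set
Percolates G r A = ∃ λ t → infected G r A t ≡ ⊤

BG : ∀ {n} → ℕ → Graph n → Set
BG r G = ∃ λ A → ∣ A ∣ ≡ r × Percolates G r A

data Reach {n} (G : Graph n) (S : Subset n) : Fin n → Fin n → Set where
  here  : ∀ {u} → u ∈ S → Reach G S u u
  there : ∀ {u v w} → Reach G S u v → adj G v w ≡ true → w ∈ S → Reach G S u w

CutSet : ∀ {n} → Graph n → Subset n → Set
CutSet G X = ∃ λ u → ∃ λ v → u ∉ X × v ∉ X × ¬ Reach G (∁ X) u v

{-# OPTIONS --safe #-}
module Submission where

-- Suppose no vertex of X is adjacent to all of A₀, and let u, v lie in different components of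
-- G − X. A vertex of a component avoiding A₀ only ever sees infected neighbours in X, fewer than
-- r of them, so it is never infected; as A₀ percolates, both components meet A₀. Now A₀ itself is
-- closed: a vertex with r = ∣A₀∣ infected neighbours in A₀ is adjacent to all of A₀, so it is not
-- in X, and outside X it would join the components of u and v. Hence A₀ never grows, and
-- percolation forces n ≤ r.

open import Defs
open import Data.Nat using (ℕ; zero; suc; _≤_; _<_; _+_; _≤ᵇ_)
open import Data.Nat.Properties using (≤ᵇ⇒≤; ≤-trans; <-irrefl; ≤-<-trans; <-≤-trans; +-comm)
open import Data.Bool using (Bool; true)
open import Data.Bool.Properties using (T-≡; _≟_)
open import Data.Fin using (Fin)
open import Data.Fin.Properties using (any?; all?)
open import Data.Fin.Subset using (Subset; _∈_; _∉_; ∣_∣; _∩_; _⊆_; ∁; ⊤)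
open import Data.Fin.Subset.Properties
  using (_∈?_; x∈p∪q⁻; x∈p∩q⁺; p∩q⊆p; p∩q⊆q; p⊆q⇒∣p∣≤∣q∣; p⊂q⇒∣p∣<∣q∣; x∉p⇒x∈∁p; ∈⊤; ∣⊤∣≡n)
open import Data.Vec using (tabulate)
open import Data.Vec.Properties using (lookup∘tabulate; []=⇒lookup)
open import Data.Product using (∃; _×_; _,_)
open import Data.Sum using (_⊎_; inj₁; inj₂)
open import Data.Empty using (⊥-elim)
open import Function.Bundles using (Equivalence)
open import Relation.Nullary using (¬_; Dec; yes; no)
open import Relation.Nullary.Decidable using (_×-dec_; _→-dec_)
open import Relation.Binary.PropositionalEquality using (_≡_; refl; subst; subst₂; trans)
  renaming (sym to ≡-sym)

∈-tabulate⁻ : ∀ {n} (f : Fin n → Bool) {x} → x ∈ tabulate f → f x ≡ true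
∈-tabulate⁻ f {x} x∈ = trans (≡-sym (lookup∘tabulate f x)) ([]=⇒lookup x∈)

AdjacentToAll : ∀ {n} → Graph n → Fin n → Subset n → Set
AdjacentToAll G x A = ∀ a → a ∈ A → adj G x a ≡ true

adjacentToAll? : ∀ {n} (G : Graph n) x A → Dec (AdjacentToAll G x A)
adjacentToAll? G x A = all? λ a → (a ∈? A) →-dec (adj G x a ≟ true)

module _ {n} (G : Graph n) (S : Subset n) where

  Reach-target : ∀ {u v} → Reach G S u v → v ∈ S
  Reach-target (here v∈S)      = v∈S
  Reach-target (there _ _ v∈S) = v∈S

  Reach-trans : ∀ {u v w} → Reach G S u v → Reach G S v w → Reach G S u w
  Reach-trans p (here _)         = p
  Reach-trans p (there q vw w∈S) = there (Reach-trans p q) vw w∈S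

  Reach-sym : ∀ {u v} → Reach G S u v → Reach G S v u
  Reach-sym (here u∈S) = here u∈S
  Reach-sym {v = w} (there {v = v} p vw w∈S) =
    Reach-trans (there (here w∈S) (trans (sym G w v) vw) (Reach-target p)) (Reach-sym p)

  Reach-via-common-neighbour : ∀ {u v a b w} → Reach G S u a → Reach G S v b → w ∈ S →
    adj G w a ≡ true → adj G w b ≡ true → Reach G S u v
  Reach-via-common-neighbour {a = a} {b} {w} ua vb w∈S wa wb =
    Reach-trans (there ua (trans (sym G a w) wa) w∈S) (Reach-sym (there vb (trans (sym G b w) wb) w∈S))

module _ {n} (G : Graph n) (r : ℕ) where

  step⁻ : ∀ {A w} → w ∈ step G r A → w ∈ A ⊎ r ≤ ∣ N G w ∩ A ∣
  step⁻ {A} {w} w∈ with x∈p∪q⁻ A _ w∈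
  ... | inj₁ w∈A = inj₁ w∈A
  ... | inj₂ w∈T = inj₂ (≤ᵇ⇒≤ r _ (Equivalence.from T-≡ (∈-tabulate⁻ (λ v → r ≤ᵇ ∣ N G v ∩ A ∣) w∈T)))

  ∈N⇒adj : ∀ {v w} → w ∈ N G v → adj G v w ≡ true
  ∈N⇒adj {v} = ∈-tabulate⁻ (adj G v)

  region-never-infected : ∀ {A} (C : Fin n → Set) (X : Subset n) → ∣ X ∣ < r →
    (∀ {v w} → C v → adj G v w ≡ true → w ∉ X → C w) →
    (∀ {w} → C w → w ∉ A) →
    ∀ t {w} → C w → w ∉ infected G r A t
  region-never-infected C X ∣X∣<r closed avoids zero = avoids
  region-never-infected {A} C X ∣X∣<r closed avoids (suc t) {w} w∈C w∈
    with step⁻ w∈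
  ... | inj₁ w∈Aₜ = region-never-infected C X ∣X∣<r closed avoids t w∈C w∈Aₜ
  ... | inj₂ r≤   = <-irrefl refl (≤-<-trans (≤-trans r≤ (p⊆q⇒∣p∣≤∣q∣ N∩Aₜ⊆X)) ∣X∣<r)
    where
    N∩Aₜ⊆X : N G w ∩ infected G r A t ⊆ X
    N∩Aₜ⊆X {y} y∈ with y ∈? X
    ... | yes y∈X = y∈X
    ... | no y∉X  = ⊥-elim (region-never-infected C X ∣X∣<r closed avoids t
                      (closed w∈C (∈N⇒adj (p∩q⊆p (N G w) _ y∈)) y∉X) (p∩q⊆q (N G w) _ y∈))

  component-meets-seed : ∀ {A X u} → Percolates G r A → ∣ X ∣ < r → u ∉ X →
    ¬ (∀ a → Reach G (∁ X) u a → a ∉ A)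
  component-meets-seed {A} {X} {u} (t , Aₜ≡⊤) ∣X∣<r u∉X avoids =
    region-never-infected (Reach G (∁ X) u) X ∣X∣<r
      (λ p vw w∉X → there p vw (x∉p⇒x∈∁p w∉X)) (avoids _) t
      (here (x∉p⇒x∈∁p u∉X)) (subst (u ∈_) (≡-sym Aₜ≡⊤) ∈⊤)

  many-neighbours⇒adjacentToAll : ∀ {A w} → ∣ A ∣ ≡ r → r ≤ ∣ N G w ∩ A ∣ → AdjacentToAll G w A
  many-neighbours⇒adjacentToAll {A} {w} ∣A∣≡r r≤ a a∈A with a ∈? (N G w ∩ A)
  ... | yes a∈ = ∈N⇒adj (p∩q⊆p (N G w) A a∈)
  ... | no a∉  = ⊥-elim (<-irrefl refl (<-≤-trans N∩A<r r≤))
    where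
    N∩A<r : ∣ N G w ∩ A ∣ < r
    N∩A<r = subst (∣ N G w ∩ A ∣ <_) ∣A∣≡r (p⊂q⇒∣p∣<∣q∣ (p∩q⊆q (N G w) A , a , a∈A , a∉))

  closed-seed-stable : ∀ {A} → ∣ A ∣ ≡ r → (∀ w → AdjacentToAll G w A → w ∈ A) →
    ∀ t → infected G r A t ⊆ A
  closed-seed-stable ∣A∣≡r closed zero w∈ = w∈
  closed-seed-stable {A} ∣A∣≡r closed (suc t) {w} w∈ with step⁻ w∈
  ... | inj₁ w∈Aₜ = closed-seed-stable ∣A∣≡r closed t w∈Aₜ
  ... | inj₂ r≤   = closed w (many-neighbours⇒adjacentToAll ∣A∣≡r
                      (≤-trans r≤ (p⊆q⇒∣p∣≤∣q∣ N∩Aₜ⊆N∩A)))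
    where
    N∩Aₜ⊆N∩A : N G w ∩ infected G r A t ⊆ N G w ∩ A
    N∩Aₜ⊆N∩A y∈ = x∈p∩q⁺ (p∩q⊆p (N G w) _ y∈ , closed-seed-stable ∣A∣≡r closed t (p∩q⊆q (N G w) _ y∈))

  closed-percolating-seed-size : ∀ {A} → Percolates G r A → ∣ A ∣ ≡ r →
    (∀ w → AdjacentToAll G w A → w ∈ A) → n ≤ r
  closed-percolating-seed-size {A} (t , Aₜ≡⊤) ∣A∣≡r closed =
    subst₂ _≤_ (∣⊤∣≡n n) ∣A∣≡r (p⊆q⇒∣p∣≤∣q∣ ⊤⊆A)
    where
    ⊤⊆A : ⊤ ⊆ A
    ⊤⊆A {w} _ = closed-seed-stable ∣A∣≡r closed t (subst (w ∈_) (≡-sym Aₜ≡⊤) ∈⊤)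

mainTheorem4 : (r n : ℕ) → 1 ≤ r → (G : Graph n) → BG r G → r + 1 ≤ n →
    (A₀ : Subset n) → Percolates G r A₀ → ∣ A₀ ∣ ≡ r →
    (X : Subset n) → CutSet G X → ∣ X ∣ < r →
    ∃ λ x → x ∈ X × (∀ a → a ∈ A₀ → adj G x a ≡ true)
mainTheorem4 r n _ G _ r+1≤n A₀ perc ∣A₀∣≡r X (u , v , u∉X , v∉X , u↮v) ∣X∣<r
  with any? (λ x → (x ∈? X) ×-dec adjacentToAll? G x A₀)
... | yes witness = witness
... | no none =
  ⊥-elim (component-meets-seed G r perc ∣X∣<r u∉X λ a ua a∈A₀ →
          component-meets-seed G r perc ∣X∣<r v∉X λ b vb b∈A₀ →
          <-irrefl refl (<-≤-trans (subst (_≤ n) (+-comm r 1) r+1≤n)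
            (closed-percolating-seed-size G r perc ∣A₀∣≡r (closed a b ua vb a∈A₀ b∈A₀))))
  where
  closed : ∀ a b → Reach G (∁ X) u a → Reach G (∁ X) v b → a ∈ A₀ → b ∈ A₀ →
    ∀ w → AdjacentToAll G w A₀ → w ∈ A₀
  closed a b ua vb a∈A₀ b∈A₀ w w~A₀ with w ∈? X
  ... | yes w∈X = ⊥-elim (none (w , w∈X , w~A₀))
  ... | no w∉X  = ⊥-elim (u↮v (Reach-via-common-neighbour G _ ua vb (x∉p⇒x∈∁p w∉X)
                                  (w~A₀ a a∈A₀) (w~A₀ b b∈A₀)))
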